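{- Let $b$ be an element of an $\omega$-complete effect monoid $M$. (1) $b/b=\lceil b\rceil$. (2) $(a_1+a_2)/b=a_1/b+a_2/b$ for all summable $a_1,a_2\in M$ with $a_1+a_2\le b$. (3) $(a\cdot b)/b=a\cdot\lceil b\rceil$ for all $a\in M$. (4) $(a/b)\cdot b=a$ for all $a\in M$ with $a\le b$. (5) $\{a\cdot b;\ a\in M\}\equiv Mb=[0,b]_M\equiv\{a;\ a\in M,\ a\le b\}$. (6) The maps $a\mapsto a\cdot b$ and $a\mapsto b\cdot a$, from $M\lceil b\rceil$ to $Mb$, are order isomorphisms.
   Context: An effect algebra is a set $E$ with an element $0$, a partial binary operation $a+b$ (the partial sum), and a total complement $a\mapsto a^\perp$, such that: the sum is commutative and associative wherever defined, $a+0=a$, $a^\perp$ is the unique element with $a+a^\perp=1$ where $1:=0^\perp$, and $a+1$ defined implies $a=0$. The order is $a\le b$ iff $b=a+c$ for some $c$. An effect monoid is an effect algebra with an associative total multiplication $\cdot$ with unit $1$ which distributes over the partial sum on both sides. It is $\omega$-complete if every increasing sequence has a supremum. The infinite sum $\sum_n x_n$ is the supremum of the finite partial sums (when these are all defined and the supremum exists). The ceiling is $\lceil b\rceil=\sum_{n=0}^\infty b\cdot(b^\perp)^n$ (the least idempotent above $b$), and for $a\le b$ the division is $a/b=\sum_{n=0}^\infty a\cdot(b^\perp)^n$, which exists. $Mp=\{a\cdot p;\ a\in M\}$. -}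

module Defs where

open import Data.Nat using (ℕ; zero; suc)
open import Data.Maybe using (Maybe; just; nothing)
open import Data.Product using (Σ; ∃; ∃-syntax; _×_; _,_)
open import Relation.Binary.PropositionalEquality using (_≡_)

record EffectAlgebra : Set₁ where
  field
    Carrier : Set
    𝟘       : Carrier
    _⊕_     : Carrier → Carrier → Maybe Carrier
    _ᗮ      : Carrier → Carrier

  𝟙 : Carrier
  𝟙 = 𝟘 ᗮ

  field
    ⊕-comm  : ∀ a b → a ⊕ b ≡ b ⊕ a
    ⊕-assoc : ∀ a b c ab abc → a ⊕ b ≡ just ab → ab ⊕ c ≡ just abc →
              Σ Carrier λ bc → (b ⊕ c ≡ just bc) × (a ⊕ bc ≡ just abc)
    ⊕-zero  : ∀ a → a ⊕ 𝟘 ≡ just a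
    ᗮ-sum   : ∀ a → a ⊕ (a ᗮ) ≡ just 𝟙
    ᗮ-unique : ∀ a b → a ⊕ b ≡ just 𝟙 → b ≡ a ᗮ
    zero-one : ∀ a x → a ⊕ 𝟙 ≡ just x → a ≡ 𝟘

  _≤_ : Carrier → Carrier → Set
  a ≤ b = Σ Carrier λ c → a ⊕ c ≡ just b

  IsSup : (ℕ → Carrier) → Carrier → Set
  IsSup x s = (∀ n → x n ≤ s) × (∀ u → (∀ n → x n ≤ u) → s ≤ u)

  IsPartialSums : (ℕ → Carrier) → (ℕ → Carrier) → Set
  IsPartialSums x p = (p 0 ≡ 𝟘) × (∀ n → p n ⊕ x n ≡ just (p (suc n)))

  IsInfSum : (ℕ → Carrier) → Carrier → Set
  IsInfSum x s = Σ (ℕ → Carrier) λ p → IsPartialSums x p × IsSup p s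

record EffectMonoid : Set₁ where
  field
    EA : EffectAlgebra
  open EffectAlgebra EA public
  field
    _·_      : Carrier → Carrier → Carrier
    ·-assoc  : ∀ a b c → (a · b) · c ≡ a · (b · c)
    ·-identityˡ : ∀ a → 𝟙 · a ≡ a
    ·-identityʳ : ∀ a → a · 𝟙 ≡ a
    ·-distribˡ : ∀ c a b s → a ⊕ b ≡ just s → (c · a) ⊕ (c · b) ≡ just (c · s)
    ·-distribʳ : ∀ c a b s → a ⊕ b ≡ just s → (a · c) ⊕ (b · c) ≡ just (s · c)

  _^_ : Carrier → ℕ → Carrier
  x ^ zero  = 𝟙
  x ^ suc n = (x ^ n) · x

  IsCeil : Carrier → Carrier → Set
  IsCeil b c = IsInfSum (λ n → b · ((b ᗮ) ^ n)) c

  IsDiv : Carrier → Carrier → Carrier → Set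
  IsDiv a b d = IsInfSum (λ n → a · ((b ᗮ) ^ n)) d

  -- Mp = {a·p ; a ∈ M}
  InMul : Carrier → Carrier → Set
  InMul p x = Σ Carrier λ a → x ≡ a · p

  IsOrderIso : (Carrier → Set) → (Carrier → Set) → (Carrier → Carrier) → Set
  IsOrderIso P Q f =
    (∀ x → P x → Q (f x)) ×
    (∀ x y → P x → P y → f x ≡ f y → x ≡ y) ×
    (∀ z → Q z → Σ Carrier λ x → P x × (f x ≡ z)) ×
    (∀ x y → P x → P y → ((x ≤ y → f x ≤ f y) × (f x ≤ f y → x ≤ y)))

record ωEffectMonoid : Set₁ where
  field
    EM : EffectMonoid
  open EffectMonoid EM public
  field
    ω-complete : ∀ (x : ℕ → Carrier) → (∀ n → x n ≤ x (suc n)) → Σ Carrier (IsSup x)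

module Submission where

-- For fixed b (module Division), with c = ⌈b⌉: c⊥ ≤ (b⊥)ⁿ makes the constant
-- series b·c⊥ a part of the series of c, so b·c⊥ = 0; hence y·c = y for y ≤ b
-- and c·c = c.  Then (a·b)/b = a·c and (a/b)·b = a·c = a follow by moving
-- multiplication through Σ, additivity of division is infSum-split, and the
-- order isomorphisms Mc ≅ Mb reflect order because x·b ≤ y·b (resp. b·x ≤ b·y)
-- dominates the series of x·c by that of y·c (resp. of c·x by that of c·y).

open import Defs
open import Data.Nat using (ℕ; zero; suc; _+_)
open import Data.Nat.Properties using (+-comm)
open import Data.Maybe using (Maybe; just)
open import Data.Maybe.Properties using (just-injective)
open import Data.Product using (Σ; _×_; _,_; proj₁; proj₂)
open import Relation.Binary.PropositionalEquality
  using (_≡_; refl; sym; trans; cong; subst; subst₂; module ≡-Reasoning)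

module EffectAlgebraFacts (E : EffectAlgebra) where
  open EffectAlgebra E

  defined-unique : ∀ {x : Maybe Carrier} {a b} → x ≡ just a → x ≡ just b → a ≡ b
  defined-unique e₁ e₂ = just-injective (trans (sym e₁) e₂)

  ⊕-assoc⁻ : ∀ a b c bc abc → b ⊕ c ≡ just bc → a ⊕ bc ≡ just abc →
             Σ Carrier λ ab → (a ⊕ b ≡ just ab) × (ab ⊕ c ≡ just abc)
  ⊕-assoc⁻ a b c bc abc e₁ e₂
    with ⊕-assoc c b a bc abc (trans (⊕-comm c b) e₁) (trans (⊕-comm bc a) e₂)
  ... | ba , e₃ , e₄ = ba , trans (⊕-comm a b) e₃ , trans (⊕-comm ba c) e₄

  ᗮ-sumˡ : ∀ a → (a ᗮ) ⊕ a ≡ just 𝟙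
  ᗮ-sumˡ a = trans (⊕-comm (a ᗮ) a) (ᗮ-sum a)

  ᗮᗮ : ∀ a → (a ᗮ) ᗮ ≡ a
  ᗮᗮ a = sym (ᗮ-unique (a ᗮ) a (ᗮ-sumˡ a))

  complement-⊕ : ∀ {a c e} → a ⊕ c ≡ just e → (e ᗮ) ⊕ a ≡ just (c ᗮ)
  complement-⊕ {a} {c} {e} a⊕c with ⊕-assoc⁻ (e ᗮ) a c e 𝟙 a⊕c (ᗮ-sumˡ e)
  ... | t , e⊥⊕a , t⊕c = subst (λ u → (e ᗮ) ⊕ a ≡ just u)
                           (ᗮ-unique c t (trans (⊕-comm c t) t⊕c)) e⊥⊕a

  -- Cancellation: b and c are both the complement of s⊥ + a.
  cancel : ∀ {a b c s} → a ⊕ b ≡ just s → a ⊕ c ≡ just s → b ≡ c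
  cancel {a} {b} {c} {s} a⊕b a⊕c = begin
    b          ≡⟨ sym (ᗮᗮ b) ⟩
    (b ᗮ) ᗮ    ≡⟨ cong _ᗮ (defined-unique (complement-⊕ a⊕b) (complement-⊕ a⊕c)) ⟩
    (c ᗮ) ᗮ    ≡⟨ ᗮᗮ c ⟩
    c          ∎
    where open ≡-Reasoning

  cancel-zero : ∀ {a b} → a ⊕ b ≡ just a → b ≡ 𝟘
  cancel-zero {a} e = cancel e (⊕-zero a)

  positive : ∀ {a b} → a ⊕ b ≡ just 𝟘 → a ≡ 𝟘
  positive {a} {b} e
    with ⊕-assoc b a 𝟙 𝟘 𝟙 (trans (⊕-comm b a) e) (trans (⊕-comm 𝟘 𝟙) (⊕-zero 𝟙))
  ... | t , a⊕1 , _ = zero-one a t a⊕1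

  ≤-refl : ∀ {a} → a ≤ a
  ≤-refl {a} = 𝟘 , ⊕-zero a

  ≡⇒≤ : ∀ {a b} → a ≡ b → a ≤ b
  ≡⇒≤ refl = ≤-refl

  ≤-trans : ∀ {a b e} → a ≤ b → b ≤ e → a ≤ e
  ≤-trans {a} (c , a⊕c) (d , b⊕d) with ⊕-assoc a c d _ _ a⊕c b⊕d
  ... | cd , _ , a⊕cd = cd , a⊕cd

  ≤-antisym : ∀ {a b} → a ≤ b → b ≤ a → a ≡ b
  ≤-antisym {a} (c , a⊕c) (d , b⊕d) with ⊕-assoc a c d _ a a⊕c b⊕d
  ... | cd , c⊕d , a⊕cd with cancel-zero a⊕cd
  ... | refl with positive c⊕d
  ... | refl = defined-unique (⊕-zero a) a⊕c

  ≤-𝟘 : ∀ {a} → a ≤ 𝟘 → a ≡ 𝟘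
  ≤-𝟘 (_ , e) = positive e

  ≤-⊕ˡ : ∀ {a c s} → a ⊕ c ≡ just s → a ≤ s
  ≤-⊕ˡ {c = c} e = c , e

  ≤-⊕ʳ : ∀ {a c s} → a ⊕ c ≡ just s → c ≤ s
  ≤-⊕ʳ {a} {c} e = a , trans (⊕-comm c a) e

  ᗮ-antitone : ∀ {a b} → a ≤ b → (b ᗮ) ≤ (a ᗮ)
  ᗮ-antitone {a} (c , a⊕c) = c , complement-⊕ (trans (⊕-comm c a) a⊕c)

  SumBelow : Carrier → Carrier → Carrier → Set
  SumBelow a c b = Σ Carrier λ t → (a ⊕ c ≡ just t) × (t ≤ b)

  sumBelow-comm : ∀ {a c b} → SumBelow a c b → SumBelow c a b
  sumBelow-comm {a} {c} (t , e , t≤b) = t , trans (⊕-comm c a) e , t≤b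

  sumBelow-≤ : ∀ {a c b b'} → SumBelow a c b → b ≤ b' → SumBelow a c b'
  sumBelow-≤ (t , e , t≤b) b≤b' = t , e , ≤-trans t≤b b≤b'

  sumBelow⇒≤residual : ∀ {a c b r} → SumBelow a c b → c ⊕ r ≡ just b → a ≤ r
  sumBelow⇒≤residual {a} {c} (t , a⊕c , (v , t⊕v)) c⊕r
    with ⊕-assoc c a v t _ (trans (⊕-comm c a) a⊕c) t⊕v
  ... | w , a⊕v , c⊕w = v , trans a⊕v (cong just (cancel c⊕w c⊕r))

  ≤residual⇒sumBelow : ∀ {a c b r} → a ≤ r → c ⊕ r ≡ just b → SumBelow a c b
  ≤residual⇒sumBelow {a} {c} {b} {r} (v , a⊕v) c⊕r
    with ⊕-assoc a v c r b a⊕v (trans (⊕-comm r c) c⊕r)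
  ... | vc , v⊕c , a⊕vc with ⊕-assoc⁻ a c v vc b (trans (⊕-comm c v) v⊕c) a⊕vc
  ... | ac , a⊕c , ac⊕v = ac , a⊕c , (v , ac⊕v)

  ⊕-mono : ∀ {a a' c c' s} → a ≤ a' → c ≤ c' → a' ⊕ c' ≡ just s → SumBelow a c s
  ⊕-mono a≤a' c≤c' a'⊕c' with ≤residual⇒sumBelow c≤c' a'⊕c'
  ... | t , c⊕a' , t≤s with ≤residual⇒sumBelow a≤a' c⊕a'
  ... | u , a⊕c , u≤t = u , a⊕c , ≤-trans u≤t t≤s

  Incr : (ℕ → Carrier) → Set
  Incr x = ∀ n → x n ≤ x (suc n)

  incr-+ : ∀ {x} → Incr x → ∀ n m → x n ≤ x (m + n)
  incr-+ inc n zero = ≤-refl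
  incr-+ inc n (suc m) = ≤-trans (incr-+ inc n m) (inc (m + n))

  sup-unique : ∀ {x s s'} → IsSup x s → IsSup x s' → s ≡ s'
  sup-unique (ub , least) (ub' , least') = ≤-antisym (least _ ub') (least' _ ub)

  sup-⊕-below : ∀ {x X a Z} → IsSup x X → (∀ n → SumBelow (x n) a Z) → SumBelow X a Z
  sup-⊕-below (_ , least) below with below 0
  ... | _ , x₀⊕a , t≤Z with ≤-trans (≤-⊕ʳ x₀⊕a) t≤Z
  ... | r , a⊕r = ≤residual⇒sumBelow (least r (λ n → sumBelow⇒≤residual (below n) a⊕r)) a⊕r

  sup-⊕ : ∀ {x y z X Y Z} → Incr x → Incr y → (∀ n → x n ⊕ y n ≡ just (z n)) →
          IsSup x X → IsSup y Y → IsSup z Z → X ⊕ Y ≡ just Z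
  sup-⊕ {x} {y} {z} {X} {Y} {Z} incx incy xyz supX@(ubX , _) supY@(ubY , _) (ubZ , leastZ) =
    sumBelow-is-sum sumsBelow
    where
    -- xₙ + yₘ ≤ z_{m+n} ≤ Z
    termsBelow : ∀ m n → SumBelow (x n) (y m) Z
    termsBelow m n = sumBelow-≤ (⊕-mono (incr-+ incx n m)
                                        (subst (λ k → y m ≤ y k) (+-comm n m) (incr-+ incy m n))
                                        (xyz (m + n)))
                                (ubZ (m + n))

    sumsBelow : SumBelow X Y Z
    sumsBelow = sumBelow-comm
      (sup-⊕-below supY (λ m → sumBelow-comm (sup-⊕-below supX (termsBelow m))))

    sumBelow-is-sum : SumBelow X Y Z → X ⊕ Y ≡ just Z
    sumBelow-is-sum (t , X⊕Y , t≤Z) = trans X⊕Y (cong just (≤-antisym t≤Z (leastZ t zₙ≤t)))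
      where
      zₙ≤t : ∀ n → z n ≤ t
      zₙ≤t n with ⊕-mono (ubX n) (ubY n) X⊕Y
      ... | s , xₙ⊕yₙ , s≤t = subst (_≤ t) (defined-unique xₙ⊕yₙ (xyz n)) s≤t

  partialSums-incr : ∀ {x p} → IsPartialSums x p → Incr p
  partialSums-incr (_ , step) n = ≤-⊕ˡ (step n)

  partialSums-unique : ∀ {x p p'} → IsPartialSums x p → IsPartialSums x p' → ∀ n → p n ≡ p' n
  partialSums-unique (p₀ , _) (p₀' , _) zero = trans p₀ (sym p₀')
  partialSums-unique {x} {p} {p'} ps@(_ , step) ps'@(_ , step') (suc n) =
    defined-unique (step n)
      (subst (λ u → u ⊕ x n ≡ just (p' (suc n))) (sym (partialSums-unique ps ps' n)) (step' n))

  sup-cong : ∀ {x y s} → (∀ n → x n ≡ y n) → IsSup x s → IsSup y s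
  sup-cong {x} {y} {s} x≡y (ub , least) =
    (λ n → subst (_≤ s) (x≡y n) (ub n)) ,
    (λ u ub' → least u (λ n → subst (_≤ u) (sym (x≡y n)) (ub' n)))

  infSum-unique : ∀ {x s s'} → IsInfSum x s → IsInfSum x s' → s ≡ s'
  infSum-unique (p , ps , sup) (p' , ps' , sup') =
    sup-unique sup (sup-cong (λ n → sym (partialSums-unique ps ps' n)) sup')

  infSum-cong : ∀ {x y s} → (∀ n → x n ≡ y n) → IsInfSum x s → IsInfSum y s
  infSum-cong {x} {y} x≡y (p , (p₀ , step) , sup) =
    p , (p₀ , λ n → subst (λ u → p n ⊕ u ≡ just (p (suc n))) (x≡y n) (step n)) , sup

  -- Archimedean property: if a + a + ⋯ has a sum S, then S + a = S, so a = 0.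
  archimedean : ∀ {a S} → IsInfSum (λ _ → a) S → a ≡ 𝟘
  archimedean {a} (p , ps@(_ , step) , supS@(ubS , leastS)) =
    cancel-zero (sup-⊕ incr (λ _ → ≤-refl) step supS constant shifted)
    where
    incr : Incr p
    incr = partialSums-incr ps
    constant : IsSup (λ _ → a) a
    constant = (λ _ → ≤-refl) , (λ u ub → ub 0)
    shifted : IsSup (λ n → p (suc n)) _
    shifted = (λ n → ubS (suc n)) , (λ u ub → leastS u (λ n → ≤-trans (incr n) (ub n)))

  record Decomposition (s : Carrier) : Set where
    constructor decomposition
    field
      left right : Carrier
      sums       : left ⊕ right ≡ just s

  record Interchange (p q x y r : Carrier) : Set where
    field
      p′ q′ : Carrier
      p⊕x   : p ⊕ x ≡ just p′
      q⊕y   : q ⊕ y ≡ just q′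
      sums  : p′ ⊕ q′ ≡ just r

  interchange : ∀ {p q x y pq xy r} → p ⊕ q ≡ just pq → x ⊕ y ≡ just xy →
                pq ⊕ xy ≡ just r → Interchange p q x y r
  interchange {p} {q} {x} {y} {pq} {xy} {r} p⊕q x⊕y pq⊕xy
    with ⊕-assoc p q xy pq r p⊕q pq⊕xy
  ... | qxy , q⊕xy , p⊕qxy with ⊕-assoc⁻ q y x xy qxy (trans (⊕-comm y x) x⊕y) q⊕xy
  ... | qy , q⊕y , qy⊕x with ⊕-assoc⁻ p x qy qxy r (trans (⊕-comm x qy) qy⊕x) p⊕qxy
  ... | px , p⊕x , px⊕qy = record { p⊕x = p⊕x ; q⊕y = q⊕y ; sums = px⊕qy }

  split-partialSums : ∀ {x y z pz} → (∀ n → x n ⊕ y n ≡ just (z n)) → IsPartialSums z pz →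
    Σ (ℕ → Carrier) λ px → Σ (ℕ → Carrier) λ py →
      IsPartialSums x px × IsPartialSums y py × (∀ n → px n ⊕ py n ≡ just (pz n))
  split-partialSums {x} {y} {z} {pz} xyz (pz₀ , stepz) =
    (λ n → left (split n)) , (λ n → right (split n)) ,
    (refl , λ n → Interchange.p⊕x (extend n)) ,
    (refl , λ n → Interchange.q⊕y (extend n)) ,
    (λ n → sums (split n))
    where
    open Decomposition
    split : ∀ n → Decomposition (pz n)
    extend : ∀ n → Interchange (left (split n)) (right (split n)) (x n) (y n) (pz (suc n))
    split zero = decomposition 𝟘 𝟘 (trans (⊕-zero 𝟘) (cong just (sym pz₀)))
    split (suc n) = decomposition (Interchange.p′ (extend n)) (Interchange.q′ (extend n))
                                  (Interchange.sums (extend n))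
    extend n = interchange (sums (split n)) (xyz n) (stepz n)

  Additive : (Carrier → Carrier) → Set
  Additive f = ∀ a b s → a ⊕ b ≡ just s → f a ⊕ f b ≡ just (f s)

  IsContraction : (Carrier → Carrier) → Set
  IsContraction f = Additive f × (∀ a → f a ≤ a)

  additive-𝟘 : ∀ {f} → Additive f → f 𝟘 ≡ 𝟘
  additive-𝟘 additive = cancel-zero (additive 𝟘 𝟘 𝟘 (⊕-zero 𝟘))

  additive-mono : ∀ {f} → Additive f → ∀ {a b} → a ≤ b → f a ≤ f b
  additive-mono {f} additive (c , a⊕c) = f c , additive _ _ _ a⊕c

  ⊕-gap : ∀ {a v s t u w} → a ⊕ v ≡ just s → s ⊕ t ≡ just u → a ⊕ w ≡ just u → t ≤ w
  ⊕-gap a⊕v s⊕t a⊕w with ⊕-assoc _ _ _ _ _ a⊕v s⊕t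
  ... | vt , v⊕t , a⊕vt = subst (_ ≤_) (cancel a⊕vt a⊕w) (≤-⊕ʳ v⊕t)

  sumBelow-self : ∀ {a t} → SumBelow a t a → t ≡ 𝟘
  sumBelow-self {a} {t} (u , a⊕t , u≤a) =
    cancel-zero (subst (λ v → a ⊕ t ≡ just v) (≤-antisym u≤a (≤-⊕ˡ a⊕t)) a⊕t)

  -- A contraction preserves all existing suprema: if s = sup f(aₙ) and f A = s + t,
  -- then t lies below every gap A − aₙ, so A + t ≤ A and t = 0.
  sup-contraction : ∀ {f a A s} → IsContraction f → IsSup a A → IsSup (λ n → f (a n)) s → f A ≡ s
  sup-contraction {f} {a} {A} {s} (additive , shrinks) supA@(ubA , _) (ubS , leastS) =
    gap-vanishes (leastS (f A) (λ n → additive-mono additive (ubA n)))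
    where
    gap-vanishes : s ≤ f A → f A ≡ s
    gap-vanishes (t , s⊕t) =
      defined-unique (subst (λ v → s ⊕ v ≡ just (f A)) t≡0 s⊕t) (⊕-zero s)
      where
      t≤gap : ∀ n → t ≤ proj₁ (ubA n)
      t≤gap n = ≤-trans (⊕-gap (proj₂ (ubS n)) s⊕t (additive _ _ _ (proj₂ (ubA n)))) (shrinks _)
      t≡0 : t ≡ 𝟘
      t≡0 = sumBelow-self (sup-⊕-below supA λ n →
              sumBelow-comm (≤residual⇒sumBelow (t≤gap n) (proj₂ (ubA n))))

  module OmegaComplete (ω-complete : ∀ x → Incr x → Σ Carrier (IsSup x)) where

    infSum-split : ∀ {x y z : ℕ → Carrier} {Z} → (∀ n → x n ⊕ y n ≡ just (z n)) → IsInfSum z Z →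
      Σ Carrier λ X → Σ Carrier λ Y → IsInfSum x X × IsInfSum y Y × (X ⊕ Y ≡ just Z)
    infSum-split xyz (pz , psz , supZ) with split-partialSums xyz psz
    ... | px , py , psx , psy , pxy
      with ω-complete px (partialSums-incr psx) | ω-complete py (partialSums-incr psy)
    ... | X , supX | Y , supY =
      X , Y , (px , psx , supX) , (py , psy , supY) ,
      sup-⊕ (partialSums-incr psx) (partialSums-incr psy) pxy supX supY supZ

    infSum-part : ∀ {x y z : ℕ → Carrier} {Z} → (∀ n → x n ⊕ y n ≡ just (z n)) → IsInfSum z Z →
      Σ Carrier λ X → IsInfSum x X × X ≤ Z
    infSum-part xyz sumZ =
      let (X , _ , sumX , _ , X⊕Y) = infSum-split xyz sumZ in X , sumX , ≤-⊕ˡ X⊕Y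

    infSum-≤ : ∀ {x y z : ℕ → Carrier} {X Z} → (∀ n → x n ⊕ y n ≡ just (z n)) →
               IsInfSum x X → IsInfSum z Z → X ≤ Z
    infSum-≤ {Z = Z} xyz sumX sumZ =
      let (X' , sumX' , X'≤Z) = infSum-part xyz sumZ in subst (_≤ Z) (infSum-unique sumX' sumX) X'≤Z

    infSum-contraction : ∀ {f x s} → IsContraction f → IsInfSum x s → IsInfSum (λ n → f (x n)) (f s)
    infSum-contraction {f} contraction@(additive , _) (p , (p₀ , step) , supS)
      with ω-complete (λ n → f (p n)) (λ n → additive-mono additive (≤-⊕ˡ (step n)))
    ... | s' , supS' =
      (λ n → f (p n)) ,
      (trans (cong f p₀) (additive-𝟘 additive) , λ n → additive _ _ _ (step n)) ,
      subst (IsSup _) (sym (sup-contraction contraction supS supS')) supS'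

module EffectMonoidFacts (M : EffectMonoid) where
  open EffectMonoid M
  open EffectAlgebraFacts EA

  ·-complementˡ : ∀ c a → (c · a) ⊕ ((c ᗮ) · a) ≡ just a
  ·-complementˡ c a = trans (·-distribʳ a c (c ᗮ) 𝟙 (ᗮ-sum c)) (cong just (·-identityˡ a))

  ·-complementʳ : ∀ a c → (a · c) ⊕ (a · (c ᗮ)) ≡ just a
  ·-complementʳ a c = trans (·-distribˡ a c (c ᗮ) 𝟙 (ᗮ-sum c)) (cong just (·-identityʳ a))

  ·-contractionˡ : ∀ c → IsContraction (c ·_)
  ·-contractionˡ c = ·-distribˡ c , λ a → (c ᗮ) · a , ·-complementˡ c a

  ·-contractionʳ : ∀ c → IsContraction (_· c)
  ·-contractionʳ c = ·-distribʳ c , λ a → a · (c ᗮ) , ·-complementʳ a c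

  ·-≤ˡ : ∀ a c → (a · c) ≤ c
  ·-≤ˡ a c = proj₂ (·-contractionˡ a) c

  ·-≤ʳ : ∀ a c → (a · c) ≤ a
  ·-≤ʳ a c = proj₂ (·-contractionʳ c) a

  InMul-≤ : ∀ {p x} → InMul p x → x ≤ p
  InMul-≤ (a , refl) = ·-≤ˡ a _

  absorbʳ : ∀ {y p} → y · (p ᗮ) ≡ 𝟘 → y · p ≡ y
  absorbʳ {y} {p} e =
    defined-unique (⊕-zero (y · p)) (subst (λ u → (y · p) ⊕ u ≡ just y) e (·-complementʳ y p))

  absorbˡ : ∀ {y p} → (p ᗮ) · y ≡ 𝟘 → p · y ≡ y
  absorbˡ {y} {p} e =
    defined-unique (⊕-zero (p · y)) (subst (λ u → (p · y) ⊕ u ≡ just y) e (·-complementˡ p y))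

  annihilateʳ : ∀ {e w y} → e · w ≡ 𝟘 → y ≤ e → y · w ≡ 𝟘
  annihilateʳ {w = w} ew≡0 y≤e =
    ≤-𝟘 (subst (_ ≤_) ew≡0 (additive-mono (proj₁ (·-contractionʳ w)) y≤e))

  annihilateˡ : ∀ {e w y} → w · e ≡ 𝟘 → y ≤ e → w · y ≡ 𝟘
  annihilateˡ {w = w} we≡0 y≤e =
    ≤-𝟘 (subst (_ ≤_) we≡0 (additive-mono (proj₁ (·-contractionˡ w)) y≤e))

  idempotent-unit : ∀ {p y} → p · p ≡ p → y ≤ p → (y · p ≡ y) × (p · y ≡ y)
  idempotent-unit {p} pp≡p y≤p =
    absorbʳ (annihilateʳ p·p⊥≡0 y≤p) , absorbˡ (annihilateˡ p⊥·p≡0 y≤p)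
    where
    p·p⊥≡0 : p · (p ᗮ) ≡ 𝟘
    p·p⊥≡0 = cancel-zero (subst (λ u → u ⊕ (p · (p ᗮ)) ≡ just p) pp≡p (·-complementʳ p p))
    p⊥·p≡0 : (p ᗮ) · p ≡ 𝟘
    p⊥·p≡0 = cancel-zero (subst (λ u → u ⊕ ((p ᗮ) · p) ≡ just p) pp≡p (·-complementˡ p p))

  commute-^ : ∀ {a x} → a · x ≡ x · a → ∀ n → a · (x ^ n) ≡ (x ^ n) · a
  commute-^ {a} {x} ax≡xa zero = trans (·-identityʳ a) (sym (·-identityˡ a))
  commute-^ {a} {x} ax≡xa (suc n) = begin
    a · ((x ^ n) · x)    ≡⟨ sym (·-assoc a (x ^ n) x) ⟩
    (a · (x ^ n)) · x    ≡⟨ cong (_· x) (commute-^ ax≡xa n) ⟩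
    ((x ^ n) · a) · x    ≡⟨ ·-assoc (x ^ n) a x ⟩
    (x ^ n) · (a · x)    ≡⟨ cong ((x ^ n) ·_) ax≡xa ⟩
    (x ^ n) · (x · a)    ≡⟨ sym (·-assoc (x ^ n) x a) ⟩
    ((x ^ n) · x) · a    ∎
    where open ≡-Reasoning

  -- b commutes with b⊥: both b·b⊥ and b⊥·b are the gap between b·b and b.
  complement-commutes : ∀ b → b · (b ᗮ) ≡ (b ᗮ) · b
  complement-commutes b = cancel (·-complementʳ b b) (·-complementˡ b b)

  ceiling-partialSums : ∀ b → IsPartialSums (λ n → b · ((b ᗮ) ^ n)) (λ n → ((b ᗮ) ^ n) ᗮ)
  ceiling-partialSums b = ᗮᗮ 𝟘 , λ n → complement-⊕ (peel n)
    where
    peel : ∀ n → (b · ((b ᗮ) ^ n)) ⊕ ((b ᗮ) ^ suc n) ≡ just ((b ᗮ) ^ n)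
    peel n = subst (λ u → (b · ((b ᗮ) ^ n)) ⊕ u ≡ just ((b ᗮ) ^ n))
               (commute-^ refl n) (·-complementˡ b ((b ᗮ) ^ n))

  orderIso : ∀ {P Q f} → (∀ x → P x → Q (f x)) → (∀ z → Q z → Σ Carrier λ x → P x × (f x ≡ z)) →
             (∀ {x y} → x ≤ y → f x ≤ f y) → (∀ {x y} → P x → P y → f x ≤ f y → x ≤ y) →
             IsOrderIso P Q f
  orderIso into onto mono reflect =
    into ,
    (λ x y px py fx≡fy → ≤-antisym (reflect px py (≡⇒≤ fx≡fy)) (reflect py px (≡⇒≤ (sym fx≡fy)))) ,
    onto ,
    (λ x y px py → mono , reflect px py)

module Division (M : ωEffectMonoid) (b : ωEffectMonoid.Carrier M) where
  open ωEffectMonoid M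
  open EffectAlgebraFacts EA
  open OmegaComplete ω-complete
  open EffectMonoidFacts EM

  q : ℕ → Carrier
  q n = (b ᗮ) ^ n

  b-q : ∀ n → b · q n ≡ q n · b
  b-q = commute-^ (complement-commutes b)

  ceiling : Σ Carrier (IsSup (λ n → q n ᗮ))
  ceiling = ω-complete _ (partialSums-incr (ceiling-partialSums b))

  c : Carrier
  c = proj₁ ceiling

  c-sup : IsSup (λ n → q n ᗮ) c
  c-sup = proj₂ ceiling

  ceil : IsCeil b c
  ceil = _ , ceiling-partialSums b , c-sup

  -- c⊥ ≤ (b⊥)ⁿ for every n, as ((b⊥)ⁿ)⊥ ≤ c.
  c⊥≤q : ∀ n → (c ᗮ) ≤ q n
  c⊥≤q n = subst ((c ᗮ) ≤_) (ᗮᗮ (q n)) (ᗮ-antitone (proj₁ c-sup n))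

  -- b·c⊥ = 0: the constant series b·c⊥ is a termwise part of the summable
  -- series b·(b⊥)ⁿ, so it is summable.
  b·c⊥≡0 : b · (c ᗮ) ≡ 𝟘
  b·c⊥≡0 = archimedean (proj₁ (proj₂ (infSum-part (λ n → ·-distribˡ b _ _ _ (proj₂ (c⊥≤q n))) ceil)))

  below-b-fixed : ∀ {y} → y ≤ b → y · c ≡ y
  below-b-fixed y≤b = absorbʳ (annihilateʳ b·c⊥≡0 y≤b)

  -- c is idempotent: c·c = Σₙ (b·(b⊥)ⁿ)·c = Σₙ b·(b⊥)ⁿ = c.
  c-idempotent : c · c ≡ c
  c-idempotent = infSum-unique
    (infSum-cong (λ n → below-b-fixed (·-≤ʳ b (q n))) (infSum-contraction (·-contractionʳ c) ceil))
    ceil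

  -- b is the first term of the series for c.
  b≤c : b ≤ c
  b≤c = ≤-trans (subst (_≤ (q 1 ᗮ)) (·-identityʳ b) (≤-⊕ʳ (proj₂ (ceiling-partialSums b) 0)))
                (proj₁ c-sup 1)

  c·b≡b : c · b ≡ b
  c·b≡b = proj₂ (idempotent-unit c-idempotent b≤c)

  -- Part (3): (a·b)/b = a·c, since a·_ commutes with infinite sums.
  div-mul : ∀ a → IsDiv (a · b) b (a · c)
  div-mul a = infSum-cong (λ n → sym (·-assoc a b (q n))) (infSum-contraction (·-contractionˡ a) ceil)

  leftDiv-mul : ∀ x → IsInfSum (λ n → q n · (b · x)) (c · x)
  leftDiv-mul x = infSum-cong reassoc (infSum-contraction (·-contractionʳ x) ceil)
    where
    reassoc : ∀ n → (b · q n) · x ≡ q n · (b · x)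
    reassoc n = trans (cong (_· x) (b-q n)) (·-assoc (q n) b x)

  div-split : ∀ {a₁ a₂ s d} → a₁ ⊕ a₂ ≡ just s → IsDiv s b d →
    Σ Carrier λ d₁ → Σ Carrier λ d₂ → IsDiv a₁ b d₁ × IsDiv a₂ b d₂ × (d₁ ⊕ d₂ ≡ just d)
  div-split a₁⊕a₂ = infSum-split (λ n → ·-distribʳ (q n) _ _ _ a₁⊕a₂)

  -- a/b exists for a ≤ b: it is a termwise part of b/b = c.
  div-exists : ∀ {a} → a ≤ b → Σ Carrier (IsDiv a b)
  div-exists (_ , a⊕g) =
    let (d , div , _) = infSum-part (λ n → ·-distribʳ (q n) _ _ _ a⊕g) ceil in d , div

  div-additive : ∀ a₁ a₂ s → a₁ ⊕ a₂ ≡ just s → s ≤ b →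
    Σ Carrier λ d₁ → Σ Carrier λ d₂ → Σ Carrier λ d →
      IsDiv a₁ b d₁ × IsDiv a₂ b d₂ × IsDiv s b d × (d₁ ⊕ d₂ ≡ just d)
  div-additive a₁ a₂ s a₁⊕a₂ s≤b =
    let (d , divS) = div-exists s≤b
        (d₁ , d₂ , div₁ , div₂ , d₁⊕d₂) = div-split a₁⊕a₂ divS
    in d₁ , d₂ , d , div₁ , div₂ , divS , d₁⊕d₂

  -- Part (4): (a/b)·b = Σₙ a·(b⊥)ⁿ·b = a·c = a.
  div-cancel : ∀ a → a ≤ b → Σ Carrier λ d → IsDiv a b d × (d · b ≡ a)
  div-cancel a a≤b = d , div , trans d·b≡a·c (below-b-fixed a≤b)
    where
    d : Carrier
    d = proj₁ (div-exists a≤b)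
    div : IsDiv a b d
    div = proj₂ (div-exists a≤b)
    reassoc : ∀ n → (a · q n) · b ≡ a · (b · q n)
    reassoc n = trans (·-assoc a (q n) b) (cong (a ·_) (sym (b-q n)))
    d·b≡a·c : d · b ≡ a · c
    d·b≡a·c = infSum-unique (infSum-cong reassoc (infSum-contraction (·-contractionʳ b) div))
                            (infSum-contraction (·-contractionˡ a) ceil)

  Mb-is-interval : ∀ a → (InMul b a → a ≤ b) × (a ≤ b → InMul b a)
  Mb-is-interval a = InMul-≤ , λ a≤b → let (d , _ , d·b≡a) = div-cancel a a≤b in d , sym d·b≡a

  Mc-fixed : ∀ {x} → InMul c x → (x · c ≡ x) × (c · x ≡ x)
  Mc-fixed x∈Mc = idempotent-unit c-idempotent (InMul-≤ x∈Mc)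

  right-iso : IsOrderIso (InMul c) (InMul b) (_· b)
  right-iso = orderIso (λ x _ → x , refl) onto (additive-mono (·-distribʳ b)) reflect
    where
    onto : ∀ z → InMul b z → Σ Carrier λ x → InMul c x × (x · b ≡ z)
    onto _ (a , refl) = a · c , (a , refl) , trans (·-assoc a c b) (cong (a ·_) c·b≡b)
    -- x·b ≤ y·b gives x·c ≤ y·c by comparing the series for (x·b)/b and (y·b)/b.
    reflect : ∀ {x y} → InMul c x → InMul c y → (x · b) ≤ (y · b) → x ≤ y
    reflect {x} {y} x∈Mc y∈Mc (_ , e) =
      subst₂ _≤_ (proj₁ (Mc-fixed x∈Mc)) (proj₁ (Mc-fixed y∈Mc))
        (infSum-≤ (λ n → ·-distribʳ (q n) _ _ _ e) (div-mul x) (div-mul y))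

  left-iso : IsOrderIso (InMul c) (InMul b) (b ·_)
  left-iso = orderIso into onto (additive-mono (·-distribˡ b)) reflect
    where
    into : ∀ x → InMul c x → InMul b (b · x)
    into x _ = proj₂ (Mb-is-interval (b · x)) (·-≤ʳ b x)
    -- e = Σₙ (b⊥)ⁿ·z is a termwise part of c = Σₙ (b⊥)ⁿ·b, and b·e = c·z = z.
    onto : ∀ z → InMul b z → Σ Carrier λ x → InMul c x × (b · x ≡ z)
    onto z z∈Mb = e , (e , sym (proj₁ (idempotent-unit c-idempotent e≤c))) , b·e≡z
      where
      z≤b : z ≤ b
      z≤b = InMul-≤ z∈Mb
      part : Σ Carrier λ e → IsInfSum (λ n → q n · z) e × e ≤ c
      part = infSum-part (λ n → ·-distribˡ (q n) _ _ _ (proj₂ z≤b)) (infSum-cong b-q ceil)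
      e : Carrier
      e = proj₁ part
      e≤c : e ≤ c
      e≤c = proj₂ (proj₂ part)
      reassoc : ∀ n → b · (q n · z) ≡ (b · q n) · z
      reassoc n = sym (·-assoc b (q n) z)
      b·e≡c·z : b · e ≡ c · z
      b·e≡c·z = infSum-unique
        (infSum-cong reassoc (infSum-contraction (·-contractionˡ b) (proj₁ (proj₂ part))))
        (infSum-contraction (·-contractionʳ z) ceil)
      b·e≡z : b · e ≡ z
      b·e≡z = trans b·e≡c·z (proj₂ (idempotent-unit c-idempotent (≤-trans z≤b b≤c)))
    reflect : ∀ {x y} → InMul c x → InMul c y → (b · x) ≤ (b · y) → x ≤ y
    reflect {x} {y} x∈Mc y∈Mc (_ , e) =
      subst₂ _≤_ (proj₂ (Mc-fixed x∈Mc)) (proj₂ (Mc-fixed y∈Mc))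
        (infSum-≤ (λ n → ·-distribˡ (q n) _ _ _ e) (leftDiv-mul x) (leftDiv-mul y))

lemma41 : (M : ωEffectMonoid) → let open ωEffectMonoid M in (b : Carrier) →
    (Σ Carrier λ c → IsDiv b b c × IsCeil b c)
    × (∀ a₁ a₂ s → a₁ ⊕ a₂ ≡ just s → s ≤ b →
         Σ Carrier λ d₁ → Σ Carrier λ d₂ → Σ Carrier λ d →
           IsDiv a₁ b d₁ × IsDiv a₂ b d₂ × IsDiv s b d × (d₁ ⊕ d₂ ≡ just d))
    × (∀ a → Σ Carrier λ d → Σ Carrier λ c →
         IsDiv (a · b) b d × IsCeil b c × (d ≡ a · c))
    × (∀ a → a ≤ b → Σ Carrier λ d → IsDiv a b d × ((d · b) ≡ a))
    × (∀ a → (InMul b a → a ≤ b) × (a ≤ b → InMul b a))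
    × (Σ Carrier λ c → IsCeil b c
         × IsOrderIso (InMul c) (InMul b) (λ a → a · b)
         × IsOrderIso (InMul c) (InMul b) (λ a → b · a))
-- Part (1) holds because b/b and ⌈b⌉ are literally the same series.
lemma41 M b =
  (c , ceil , ceil) ,
  div-additive ,
  (λ a → a · c , c , div-mul a , ceil , refl) ,
  div-cancel ,
  Mb-is-interval ,
  (c , ceil , right-iso , left-iso)
  where
  open ωEffectMonoid M using (_·_)
  open Division M b
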